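{- Let $G$ be a finite simple connected graph with weight function $\omega:E(G)\to\{1,2,3,\dots\}$, let $p$ be a pebble distribution on $G_\omega$ and $x\in V(G)$. The following are equivalent: (1) $x$ is reachable from $p$; (2) there is a finite multiset $S$ of pebbling moves with $p_S\ge 0$ and $p_S(x)\ge 1$; (3) there is a finite acyclic multiset $R$ of pebbling moves with $p_R\ge 0$ and $p_R(x)\ge 1$; (4) $x$ is reachable from $p$ through a regular pebbling sequence, i.e. there is a regular sequence $s$ executable from $p$ with $p_s(x)\ge1$.
   Context: A pebble function is a map $p:V(G)\to\mathbb{Z}$; a pebble distribution is a nonnegative pebble function. For $vu\in E(G)$, the pebbling move $(v\to u)$ replaces $p$ by $p_{(v\to u)}$ with $p_{(v\to u)}(v)=p(v)-\omega(vu)$, $p_{(v\to u)}(u)=p(u)+1$, other values unchanged. For a sequence $s=(s_1,\dots,s_k)$ of moves, $p_s$ is the result of applying the moves in order; $s$ is executable from $p$ if $p_{(s_1,\dots,s_i)}\ge0$ for all $i$. The vertex $x$ is reachable from $p$ if there is a sequence $s$ executable from $p$ with $p_s(x)\ge 1$. For a finite multiset $S$ of moves, $p_S$ is the result of applying all moves of $S$ (order independent). The transition digraph $T(G,S)$ is the directed multigraph on $V(G)$ with one arc $(v,u)$ per copy of $(v\to u)$ in $S$; $S$ is acyclic if $T(G,S)$ has no directed cycle. An element $(v\to u)\in S$ is an initial move of $S$ if $v$ has in-degree $0$ in $T(G,S)$. A sequence $s=(s_1,\dots,s_k)$ is regular if, with $S$ the multiset of its moves, $s_i$ is an initial move of $S\setminus\{s_1,\dots,s_{i-1}\}$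 for all $i$. -}

module Defs where

open import Data.Nat using (ℕ; zero; suc)
open import Data.Integer as ℤ using (ℤ; +_; 0ℤ; 1ℤ; _-_)
open import Data.Fin using (Fin; _≟_)
open import Data.Bool using (Bool; T; true; false)
open import Data.List using (List; []; _∷_)
open import Data.List.Membership.Propositional using (_∈_)
open import Data.Product using (Σ; ∃; _×_; _,_)
open import Data.Unit using (⊤)
open import Relation.Nullary using (¬_; yes; no)
open import Relation.Binary.PropositionalEquality using (_≡_; _≢_)
open import Relation.Binary.Construct.Closure.ReflexiveTransitive using (Star)
open import Relation.Binary.Construct.Closure.Transitive using (TransClosure)

record SimpleGraph (n : ℕ) : Set where
  field
    adj     : Fin n → Fin n → Bool
    adj-sym : ∀ u v → adj u v ≡ adj v u
    irrefl  : ∀ v → adj v v ≡ false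

module _ {n : ℕ} (G : SimpleGraph n) where
  open SimpleGraph G

  Adj : Fin n → Fin n → Set
  Adj u v = T (adj u v)

  Connected : Set
  Connected = ∀ u v → Star Adj u v

  -- ω : E(G) → {1,2,3,...}, given as a symmetric vertex-pair function
  -- whose values on edges are ≥ 1 (values on non-edges are irrelevant).
  record Weight : Set where
    field
      ω     : Fin n → Fin n → ℕ
      ω-sym : ∀ u v → ω u v ≡ ω v u
      ω-pos : ∀ u v → Adj u v → Data.Nat._≤_ 1 (ω u v)

  PebbleFunction : Set
  PebbleFunction = Fin n → ℤ

  NonNeg : PebbleFunction → Set
  NonNeg p = ∀ v → 0ℤ ℤ.≤ p v

  record Move : Set where
    constructor _⟶_∶_
    field
      from : Fin n
      to   : Fin n
      edge : Adj from to
  open Move public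

  module _ (W : Weight) where
    open Weight W

    applyMove : PebbleFunction → Move → PebbleFunction
    applyMove p m w with w ≟ from m | w ≟ to m
    ... | yes _ | yes _ = p w - + ω (from m) (to m) ℤ.+ 1ℤ
    ... | yes _ | no _  = p w - + ω (from m) (to m)
    ... | no _  | yes _ = p w ℤ.+ 1ℤ
    ... | no _  | no _  = p w

    -- p_s for a sequence s (moves applied in order); also used as p_S for a
    -- finite multiset S represented by a list (result is order independent).
    applySeq : PebbleFunction → List Move → PebbleFunction
    applySeq p []      = p
    applySeq p (m ∷ s) = applySeq (applyMove p m) s

    Executable : PebbleFunction → List Move → Set
    Executable p []      = ⊤
    Executable p (m ∷ s) = NonNeg (applyMove p m) × Executable (applyMove p m) s

    Reachable : PebbleFunction → Fin n → Set
    Reachable p x = Σ (List Move) λ s → Executable p s × (1ℤ ℤ.≤ applySeq p s x)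

  -- Arcs of the transition digraph T(G,S): one arc (v,u) per copy of (v→u) in S.
  Arc : List Move → Fin n → Fin n → Set
  Arc S v u = Σ Move λ m → m ∈ S × from m ≡ v × to m ≡ u

  Acyclic : List Move → Set
  Acyclic S = ¬ (Σ (Fin n) λ v → TransClosure (Arc S) v v)

  InitialMove : List Move → Move → Set
  InitialMove S m = m ∈ S × (∀ m′ → m′ ∈ S → to m′ ≢ from m)

  -- s regular: s_i is an initial move of S ∖ {s_1,…,s_{i-1}}, which as a
  -- multiset is exactly the remaining suffix (s_i,…,s_k).
  Regular : List Move → Set
  Regular []      = ⊤
  Regular (m ∷ s) = InitialMove (m ∷ s) m × Regular s

-- Write p_S = p + Σ_{m ∈ S} effect m, so that p_S depends only on the multiset S.
-- Given p_S ≥ 0, either S has an initial move m, which can be fired first since nothing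
-- fed back into its source is needed there, or every move has a predecessor and T(G,S)
-- contains a cycle of distinct moves.  Along a cycle the effect telescopes: each vertex
-- loses ω ≥ 1 and gains 1, so deleting the cycle from S only increases p_S.  Induction on
-- |S| yields a regular executable sequence s with p_S ≤ p_s, and a regular sequence is
-- acyclic because its first move starts at a vertex of in-degree 0.

module Submission where

open import Defs
open import Data.Nat using (ℕ)
open import Data.Fin using (Fin)
open import Data.Integer using (1ℤ; _≤_)
open import Data.List using (List)
open import Data.Product using (Σ; _×_)
open import Function.Bundles using (_⇔_)

import Data.Nat as ℕ
import Data.Nat.Properties as ℕ
open import Data.Nat.Induction using (<-wellFounded)
open import Data.Fin using (_≟_)
open import Data.Integer using (ℤ; +_; 0ℤ; -_; _+_; +≤+)
open import Data.Integer.Properties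
  using (≤-refl; ≤-reflexive; ≤-trans; +-monoʳ-≤; +-monoˡ-≤; +-mono-≤; +-assoc; +-identityʳ;
         +-identityˡ; +-comm; +-inverseˡ; +-inverseʳ; neg-≤-pos; +-commutativeSemigroup; module ≤-Reasoning)
open import Algebra.Properties.CommutativeSemigroup +-commutativeSemigroup using (x∙yz≈y∙xz)
open import Data.Bool using (T)
open import Data.List using ([]; _∷_; _++_; length; map)
open import Data.List.Properties using (length-map; length-++; length-tabulate)
open import Data.List.Membership.Propositional using (_∈_; find; lose)
open import Data.List.Membership.Propositional.Properties using (∈-∃++; ∈-++⁺ʳ; ∈-allFin)
open import Data.List.Relation.Unary.Any using (here; there; any?)
open import Data.List.Relation.Unary.All using (All; []; _∷_)
open import Data.List.Relation.Unary.All.Properties using (¬Any⇒All¬; All¬⇒¬Any)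
open import Data.List.Relation.Unary.AllPairs using ([]; _∷_)
open import Data.List.Relation.Unary.Unique.Propositional using (Unique)
import Data.List.Relation.Unary.Unique.Propositional.Properties as Unique
open import Data.List.Relation.Binary.Subset.Propositional using (_⊆_)
open import Data.List.Relation.Binary.Subset.Propositional.Properties
  using (⊆-trans; ⊆-respʳ-↭; ⊆∷∧∉⇒⊆; ∈-∷⁺ʳ; ∷⁺ʳ; All-resp-⊇)
  renaming (map⁺ to map⁺-⊆)
open import Data.List.Relation.Binary.Permutation.Propositional as ↭
  using (_↭_; prep; ↭-refl; ↭-sym; ↭-trans)
open import Data.List.Relation.Binary.Permutation.Propositional.Properties
  using (shift; ↭-length; ∈-resp-↭)
open import Data.Product using (∃-syntax; _,_)
open import Data.Sum using (_⊎_; inj₁; inj₂)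
open import Data.Unit using (tt)
open import Data.Empty using (⊥-elim)
open import Function using (_∘_)
open import Function.Bundles using (mk⇔)
open import Induction.WellFounded using (Acc; acc)
open import Relation.Nullary using (Dec; yes; no)
open import Relation.Nullary.Decidable using (¬?)
open import Relation.Binary.PropositionalEquality
  using (_≡_; _≢_; refl; sym; trans; cong; subst; module ≡-Reasoning)
open import Relation.Binary.Construct.Closure.Transitive using (TransClosure; [_]; _∷_)

module _ {a} {A : Set a} where

  ∈⇒↭∷ : ∀ {x : A} {ys} → x ∈ ys → ∃[ zs ] ys ↭ x ∷ zs
  ∈⇒↭∷ x∈ys with hs , ts , refl ← ∈-∃++ x∈ys = hs ++ ts , shift _ hs ts

  unique-⊆⇒↭++ : ∀ {xs ys : List A} → Unique xs → xs ⊆ ys → ∃[ zs ] ys ↭ xs ++ zs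
  unique-⊆⇒↭++ {[]} {ys} [] _ = ys , ↭-refl
  unique-⊆⇒↭++ {x ∷ xs} (x≢xs ∷ xs!) x∷xs⊆ys
    with ys′ , ys↭x∷ys′ ← ∈⇒↭∷ (x∷xs⊆ys (here refl))
    with zs , ys′↭xs++zs ← unique-⊆⇒↭++ xs!
           (⊆∷∧∉⇒⊆ (⊆-respʳ-↭ ys↭x∷ys′ (x∷xs⊆ys ∘ there)) (All¬⇒¬Any x≢xs))
    = zs , ↭-trans ys↭x∷ys′ (prep x ys′↭xs++zs)

  unique-⊆⇒length≤ : ∀ {xs ys : List A} → Unique xs → xs ⊆ ys → length xs ℕ.≤ length ys
  unique-⊆⇒length≤ {xs} {ys} xs! xs⊆ys with zs , ys↭xs++zs ← unique-⊆⇒↭++ xs! xs⊆ys = begin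
    length xs               ≤⟨ ℕ.m≤m+n (length xs) (length zs) ⟩
    length xs ℕ.+ length zs ≡⟨ length-++ xs ⟨
    length (xs ++ zs)       ≡⟨ ↭-length ys↭xs++zs ⟨
    length ys               ∎
    where open ℕ.≤-Reasoning

unique⇒length≤ : ∀ {n} {vs : List (Fin n)} → Unique vs → length vs ℕ.≤ n
unique⇒length≤ {n} vs! =
  ℕ.≤-trans (unique-⊆⇒length≤ vs! (λ {v} _ → ∈-allFin v))
            (ℕ.≤-reflexive (length-tabulate {n = n} (λ i → i)))

+-cancelʳ-≤ : ∀ {i j} k → i + k ≤ j + k → i ≤ j
+-cancelʳ-≤ {i} {j} k i+k≤j+k = begin
  i           ≡⟨ cancel i ⟨
  i + k + - k ≤⟨ +-monoˡ-≤ (- k) i+k≤j+k ⟩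
  j + k + - k ≡⟨ cancel j ⟩
  j           ∎
  where
  open ≤-Reasoning
  cancel : ∀ l → l + k + - k ≡ l
  cancel l = trans (+-assoc l k (- k)) (trans (cong (λ z → l + z) (+-inverseʳ k)) (+-identityʳ l))

module Pebbling {n : ℕ} (G : SimpleGraph n) (W : Weight G) where
  open SimpleGraph G
  open Weight W
  open import Data.List.Membership.DecPropositional (_≟_ {n}) using (_∈?_)

  ω⟨_⟩ : Move G → ℕ
  ω⟨ m ⟩ = ω (from m) (to m)

  to≢from : (m : Move G) → to m ≢ from m
  to≢from m to≡from = subst T (irrefl (from m)) (subst (T ∘ adj (from m)) to≡from (edge m))

  𝟙 : Fin n → Fin n → ℤ
  𝟙 a w with w ≟ a
  ... | yes _ = 1ℤ
  ... | no _  = 0ℤ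

  effect : Move G → Fin n → ℤ
  effect m w with w ≟ from m | w ≟ to m
  ... | yes _ | yes _ = - + ω⟨ m ⟩ + 1ℤ
  ... | yes _ | no _  = - + ω⟨ m ⟩
  ... | no _  | yes _ = 1ℤ
  ... | no _  | no _  = 0ℤ

  applyMove≡+effect : ∀ p m w → applyMove G W p m w ≡ p w + effect m w
  applyMove≡+effect p m w with w ≟ from m | w ≟ to m
  ... | yes _ | yes _ = +-assoc (p w) (- + ω⟨ m ⟩) 1ℤ
  ... | yes _ | no _  = refl
  ... | no _  | yes _ = refl
  ... | no _  | no _  = sym (+-identityʳ (p w))

  effect-nonneg : ∀ m {w} → w ≢ from m → 0ℤ ≤ effect m w
  effect-nonneg m {w} w≢from with w ≟ from m | w ≟ to m
  ... | yes w≡from | _     = ⊥-elim (w≢from w≡from)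
  ... | no _       | yes _ = +≤+ ℕ.z≤n
  ... | no _       | no _  = ≤-refl

  effect-nonpos : ∀ m {w} → to m ≢ w → effect m w ≤ 0ℤ
  effect-nonpos m {w} to≢w with w ≟ from m | w ≟ to m
  ... | _     | yes w≡to = ⊥-elim (to≢w (sym w≡to))
  ... | yes _ | no _     = neg-≤-pos
  ... | no _  | no _     = ≤-refl

  effect+𝟙source≤𝟙target : ∀ m w → effect m w + 𝟙 (from m) w ≤ 𝟙 (to m) w
  effect+𝟙source≤𝟙target m w with w ≟ from m | w ≟ to m
  ... | yes w≡from | yes w≡to = ⊥-elim (to≢from m (trans (sym w≡to) w≡from))
  ... | yes _      | no _     = begin
    - + ω⟨ m ⟩ + 1ℤ       ≤⟨ +-monoʳ-≤ (- + ω⟨ m ⟩) (+≤+ (ω-pos (from m) (to m) (edge m))) ⟩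
    - + ω⟨ m ⟩ + + ω⟨ m ⟩ ≡⟨ +-inverseˡ (+ ω⟨ m ⟩) ⟩
    0ℤ                    ∎
    where open ≤-Reasoning
  ... | no _       | yes _    = ≤-refl
  ... | no _       | no _     = ≤-refl

  netEffect : List (Move G) → Fin n → ℤ
  netEffect []      w = 0ℤ
  netEffect (m ∷ S) w = effect m w + netEffect S w

  applySeq≡+netEffect : ∀ p S w → applySeq G W p S w ≡ p w + netEffect S w
  applySeq≡+netEffect p []      w = sym (+-identityʳ (p w))
  applySeq≡+netEffect p (m ∷ S) w = begin
    applySeq G W (applyMove G W p m) S w ≡⟨ applySeq≡+netEffect (applyMove G W p m) S w ⟩
    applyMove G W p m w + netEffect S w  ≡⟨ cong (_+ netEffect S w) (applyMove≡+effect p m w) ⟩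
    p w + effect m w + netEffect S w     ≡⟨ +-assoc (p w) (effect m w) (netEffect S w) ⟩
    p w + (effect m w + netEffect S w)   ∎
    where open ≡-Reasoning

  netEffect-↭ : ∀ {S S′} → S ↭ S′ → ∀ w → netEffect S w ≡ netEffect S′ w
  netEffect-↭ ↭.refl          w = refl
  netEffect-↭ (↭.prep m σ)    w = cong (λ z → effect m w + z) (netEffect-↭ σ w)
  netEffect-↭ (↭.swap m m′ σ) w =
    trans (x∙yz≈y∙xz (effect m w) (effect m′ w) _)
          (cong (λ z → effect m′ w + (effect m w + z)) (netEffect-↭ σ w))
  netEffect-↭ (↭.trans σ τ)   w = trans (netEffect-↭ σ w) (netEffect-↭ τ w)

  _≼_ : PebbleFunction G → PebbleFunction G → Set
  p ≼ q = ∀ w → p w ≤ q w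

  applySeq-++ : ∀ p S S′ → applySeq G W p (S ++ S′) ≡ applySeq G W (applySeq G W p S) S′
  applySeq-++ p []      S′ = refl
  applySeq-++ p (m ∷ S) S′ = applySeq-++ (applyMove G W p m) S S′

  applySeq-↭ : ∀ p {S S′} → S ↭ S′ → ∀ w → applySeq G W p S w ≡ applySeq G W p S′ w
  applySeq-↭ p {S} {S′} σ w = begin
    applySeq G W p S w   ≡⟨ applySeq≡+netEffect p S w ⟩
    p w + netEffect S w  ≡⟨ cong (λ z → p w + z) (netEffect-↭ σ w) ⟩
    p w + netEffect S′ w ≡⟨ applySeq≡+netEffect p S′ w ⟨
    applySeq G W p S′ w  ∎
    where open ≡-Reasoning

  applySeq-mono : ∀ {p q} S → p ≼ q → applySeq G W p S ≼ applySeq G W q S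
  applySeq-mono {p} {q} S p≼q w = begin
    applySeq G W p S w   ≡⟨ applySeq≡+netEffect p S w ⟩
    p w + netEffect S w  ≤⟨ +-monoˡ-≤ (netEffect S w) (p≼q w) ⟩
    q w + netEffect S w  ≡⟨ applySeq≡+netEffect q S w ⟨
    applySeq G W q S w   ∎
    where open ≤-Reasoning

  p≤applyMove : ∀ p m {w} → w ≢ from m → p w ≤ applyMove G W p m w
  p≤applyMove p m {w} w≢from = begin
    p w                 ≡⟨ +-identityʳ (p w) ⟨
    p w + 0ℤ            ≤⟨ +-monoʳ-≤ (p w) (effect-nonneg m w≢from) ⟩
    p w + effect m w    ≡⟨ applyMove≡+effect p m w ⟨
    applyMove G W p m w ∎
    where open ≤-Reasoning

  netEffect-unentered : ∀ S {w} → (∀ m → m ∈ S → to m ≢ w) → netEffect S w ≤ 0ℤ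
  netEffect-unentered []      _         = ≤-refl
  netEffect-unentered (m ∷ S) unentered =
    +-mono-≤ (effect-nonpos m (unentered m (here refl))) (netEffect-unentered S (λ m′ → unentered m′ ∘ there))

  applySeq-unentered : ∀ p S {w} → (∀ m → m ∈ S → to m ≢ w) → applySeq G W p S w ≤ p w
  applySeq-unentered p S {w} unentered = begin
    applySeq G W p S w  ≡⟨ applySeq≡+netEffect p S w ⟩
    p w + netEffect S w ≤⟨ +-monoʳ-≤ (p w) (netEffect-unentered S unentered) ⟩
    p w + 0ℤ            ≡⟨ +-identityʳ (p w) ⟩
    p w                 ∎
    where open ≤-Reasoning

  data Walk : Fin n → Fin n → List (Move G) → Set where
    []   : ∀ {a} → Walk a a []
    step : ∀ {a b L} m → to m ≡ a → Walk a b L → Walk (from m) b (m ∷ L)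

  netEffect-walk : ∀ {a b L} → Walk a b L → ∀ w → netEffect L w + 𝟙 a w ≤ 𝟙 b w
  netEffect-walk []                         w = ≤-reflexive (+-identityˡ _)
  netEffect-walk (step {L = L} m refl walk) w = begin
    effect m w + netEffect L w + 𝟙 (from m) w   ≡⟨ cong (_+ 𝟙 (from m) w) (+-comm (effect m w) (netEffect L w)) ⟩
    netEffect L w + effect m w + 𝟙 (from m) w   ≡⟨ +-assoc (netEffect L w) (effect m w) (𝟙 (from m) w) ⟩
    netEffect L w + (effect m w + 𝟙 (from m) w) ≤⟨ +-monoʳ-≤ (netEffect L w) (effect+𝟙source≤𝟙target m w) ⟩
    netEffect L w + 𝟙 (to m) w                  ≤⟨ netEffect-walk walk w ⟩
    𝟙 _ w                                       ∎
    where open ≤-Reasoning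

  netEffect-closedWalk : ∀ {a L} → Walk a a L → ∀ w → netEffect L w ≤ 0ℤ
  netEffect-closedWalk {a} walk w =
    +-cancelʳ-≤ (𝟙 a w) (≤-trans (netEffect-walk walk w) (≤-reflexive (sym (+-identityˡ (𝟙 a w)))))

  applySeq-closedWalk : ∀ {a L} → Walk a a L → ∀ p → applySeq G W p L ≼ p
  applySeq-closedWalk {L = L} walk p w = begin
    applySeq G W p L w  ≡⟨ applySeq≡+netEffect p L w ⟩
    p w + netEffect L w ≤⟨ +-monoʳ-≤ (p w) (netEffect-closedWalk walk w) ⟩
    p w + 0ℤ            ≡⟨ +-identityʳ (p w) ⟩
    p w                 ∎
    where open ≤-Reasoning

  cutWalkAt : ∀ {a b L} v → Walk a b L → Unique (map from L) → v ∈ map from L →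
    ∃[ K ] Walk a v K × Unique (map from K) × All (v ≢_) (map from K) × K ⊆ L
  cutWalkAt v (step m e walk) (from≢ ∷ uniq) v∈ with v ≟ from m | v∈
  ... | yes refl | _           = [] , [] , [] , [] , λ ()
  ... | no v≢    | here v≡     = ⊥-elim (v≢ v≡)
  ... | no v≢    | there v∈′
    with K , walkK , uniqK , v∉K , K⊆L ← cutWalkAt v walk uniq v∈′
    = m ∷ K , step m e walkK , All-resp-⊇ (map⁺-⊆ from K⊆L) from≢ ∷ uniqK , v≢ ∷ v∉K , ∷⁺ʳ m K⊆L

  HasPredecessors : List (Move G) → Set
  HasPredecessors S = ∀ {m} → m ∈ S → ∃[ y ] y ∈ S × to y ≡ from m

  initialMove⊎hasPredecessors : ∀ S → (∃[ m ] InitialMove G S m) ⊎ HasPredecessors S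
  initialMove⊎hasPredecessors S with any? (λ m → ¬? (any? (λ y → to y ≟ from m) S)) S
  ... | yes hit with m , m∈S , unentered ← find hit = inj₁ (m , m∈S , λ y y∈S e → unentered (lose y∈S e))
  ... | no noInitial = inj₂ predecessor
    where
    predecessor : HasPredecessors S
    predecessor {m} m∈S with any? (λ y → to y ≟ from m) S
    ... | yes entered = find entered
    ... | no unentered = ⊥-elim (noInitial (lose m∈S unentered))

  record Cycle (S : List (Move G)) : Set where
    field
      first    : Move G
      rest     : List (Move G)
      closed   : Walk (from first) (from first) (first ∷ rest)
      distinct : Unique (first ∷ rest)
      ⊆S       : first ∷ rest ⊆ S

  -- Grow a backward walk with distinct sources until a predecessor closes it up;
  -- the number of sources, at most n, bounds the fuel k.
  extendToCycle : ∀ {S} → HasPredecessors S → ∀ k {m L b} → n ℕ.≤ k ℕ.+ length (m ∷ L) →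
    Walk (from m) b (m ∷ L) → Unique (map from (m ∷ L)) → m ∷ L ⊆ S → Cycle S
  extendToCycle pred k {m} {L} bound walk uniq m∷L⊆S
    with y , y∈S , to-y≡ ← pred (m∷L⊆S (here refl))
    with from y ∈? map from (m ∷ L)
  ... | yes closes with K , walkK , uniqK , y∉K , K⊆ ← cutWalkAt (from y) walk uniq closes =
    record { first = y ; rest = K ; closed = step y to-y≡ walkK
           ; distinct = Unique.map⁻ (y∉K ∷ uniqK) ; ⊆S = ∈-∷⁺ʳ y∈S (⊆-trans K⊆ m∷L⊆S) }
  ... | no fresh with k
  ...   | ℕ.zero = ⊥-elim (ℕ.<⇒≱ (ℕ.≤-trans (ℕ.≤-reflexive (sym (length-map from (y ∷ m ∷ L))))
                                    (unique⇒length≤ (¬Any⇒All¬ _ fresh ∷ uniq))) bound)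
  ...   | ℕ.suc k′ = extendToCycle pred k′ (ℕ.≤-trans bound (ℕ.≤-reflexive (sym (ℕ.+-suc k′ _))))
                       (step y to-y≡ walk) (¬Any⇒All¬ _ fresh ∷ uniq) (∈-∷⁺ʳ y∈S m∷L⊆S)

  hasPredecessors⇒cycle : ∀ {S m} → HasPredecessors S → m ∈ S → Cycle S
  hasPredecessors⇒cycle {m = m} pred m∈S =
    extendToCycle pred n (ℕ.m≤m+n n 1) (step m refl []) ([] ∷ []) (λ { (here refl) → m∈S })

  record Regularisation (p : PebbleFunction G) (S : List (Move G)) : Set where
    field
      sequence   : List (Move G)
      regular    : Regular G sequence
      executable : Executable G W p sequence
      dominates  : applySeq G W p S ≼ applySeq G W p sequence
      ⊆S         : sequence ⊆ S

  regularisation-[] : ∀ p → Regularisation p []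
  regularisation-[] p = record
    { sequence = [] ; regular = tt ; executable = tt ; dominates = λ _ → ≤-refl ; ⊆S = λ () }

  regularisation-∷ : ∀ {p m S} → (∀ y → y ∈ m ∷ S → to y ≢ from m) → NonNeg G (applyMove G W p m) →
    Regularisation (applyMove G W p m) S → Regularisation p (m ∷ S)
  regularisation-∷ {m = m} unentered p′≥0 r = record
    { sequence   = m ∷ sequence
    ; regular    = (here refl , unentered′) , regular
    ; executable = p′≥0 , executable
    ; dominates  = dominates
    ; ⊆S         = ∷⁺ʳ m ⊆S
    }
    where
    open Regularisation r
    unentered′ : ∀ y → y ∈ m ∷ sequence → to y ≢ from m
    unentered′ y (here refl) = to≢from m
    unentered′ y (there y∈)  = unentered y (there (⊆S y∈))

  regularisation-⊇ : ∀ {p S S′} → applySeq G W p S ≼ applySeq G W p S′ → S′ ⊆ S →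
    Regularisation p S′ → Regularisation p S
  regularisation-⊇ pS≼pS′ S′⊆S r = record
    { sequence   = sequence
    ; regular    = regular
    ; executable = executable
    ; dominates  = λ w → ≤-trans (pS≼pS′ w) (dominates w)
    ; ⊆S         = S′⊆S ∘ ⊆S
    }
    where open Regularisation r

  -- No move of S puts pebbles back on the source of m, so p_m holds at least p_S there.
  initialMove-nonneg : ∀ {p S S′ m} → NonNeg G p → S ↭ m ∷ S′ → (∀ y → y ∈ S → to y ≢ from m) →
    NonNeg G (applySeq G W p S) → NonNeg G (applyMove G W p m)
  initialMove-nonneg {p} {S} {S′} {m} p≥0 σ unentered pS≥0 w = atSource? (w ≟ from m)
    where
    open ≤-Reasoning
    atSource? : Dec (w ≡ from m) → 0ℤ ≤ applyMove G W p m w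
    atSource? (yes refl) = begin
      0ℤ                                    ≤⟨ pS≥0 w ⟩
      applySeq G W p S w                    ≡⟨ applySeq-↭ p σ w ⟩
      applySeq G W (applyMove G W p m) S′ w ≤⟨ applySeq-unentered _ S′ (λ y → unentered y ∘ S′⊆S) ⟩
      applyMove G W p m w                   ∎
      where
      S′⊆S : S′ ⊆ S
      S′⊆S = ∈-resp-↭ (↭-sym σ) ∘ there
    atSource? (no w≢from) = ≤-trans (p≥0 w) (p≤applyMove p m w≢from)

  cycle-removal-≼ : ∀ p {S C S′ a} → S ↭ C ++ S′ → Walk a a C → applySeq G W p S ≼ applySeq G W p S′
  cycle-removal-≼ p {S} {C} {S′} σ closed w = begin
    applySeq G W p S w                    ≡⟨ applySeq-↭ p σ w ⟩
    applySeq G W p (C ++ S′) w            ≡⟨ cong (λ q → q w) (applySeq-++ p C S′) ⟩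
    applySeq G W (applySeq G W p C) S′ w  ≤⟨ applySeq-mono S′ (applySeq-closedWalk closed p) w ⟩
    applySeq G W p S′ w                   ∎
    where open ≤-Reasoning

  regularise : ∀ {p} → NonNeg G p → ∀ S → Acc ℕ._<_ (length S) → NonNeg G (applySeq G W p S) →
    Regularisation p S
  regularise {p} p≥0 [] _ _ = regularisation-[] p
  regularise {p} p≥0 S@(_ ∷ _) (acc shorter) pS≥0 with initialMove⊎hasPredecessors S
  ... | inj₁ (m , m∈S , unentered) with S′ , σ ← ∈⇒↭∷ m∈S =
    regularisation-⊇ {S′ = m ∷ S′} (≤-reflexive ∘ applySeq-↭ p σ) (∈-resp-↭ (↭-sym σ))
      (regularisation-∷ (λ y → unentered y ∘ ∈-resp-↭ (↭-sym σ)) p′≥0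
        (regularise p′≥0 S′ (shorter (ℕ.≤-reflexive (sym (↭-length σ))))
          (λ w → ≤-trans (pS≥0 w) (≤-reflexive (applySeq-↭ p σ w)))))
    where
    p′≥0 : NonNeg G (applyMove G W p m)
    p′≥0 = initialMove-nonneg p≥0 σ unentered pS≥0
  ... | inj₂ pred with record { first = c ; rest = C ; closed = closed ; distinct = distinct ; ⊆S = C⊆S }
                         ← hasPredecessors⇒cycle pred (here refl)
                  with S′ , σ ← unique-⊆⇒↭++ distinct C⊆S =
    regularisation-⊇ pS≼pS′ (λ y∈ → ∈-resp-↭ (↭-sym σ) (∈-++⁺ʳ (c ∷ C) y∈))
      (regularise p≥0 S′ (shorter S′<S) (λ w → ≤-trans (pS≥0 w) (pS≼pS′ w)))
    where
    pS≼pS′ : applySeq G W p S ≼ applySeq G W p S′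
    pS≼pS′ = cycle-removal-≼ p σ closed
    S′<S : length S′ ℕ.< length S
    S′<S = ℕ.≤-trans (ℕ.s≤s (ℕ.m≤n+m (length S′) (length C)))
                     (ℕ.≤-reflexive (sym (trans (↭-length σ) (length-++ (c ∷ C)))))

  executable⇒nonneg : ∀ {p} s → NonNeg G p → Executable G W p s → NonNeg G (applySeq G W p s)
  executable⇒nonneg []      p≥0 _              = p≥0
  executable⇒nonneg (m ∷ s) _   (p′≥0 , exec) = executable⇒nonneg s p′≥0 exec

  lastArc : ∀ {S a b} → TransClosure (Arc G S) a b → ∃[ m ] m ∈ S × to m ≡ b
  lastArc [ m , m∈S , _ , to≡b ] = m , m∈S , to≡b
  lastArc (_ ∷ arcs)             = lastArc arcs

  -- No arc enters from m, so a path not starting there never uses an arc of m.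
  dropInitialMove : ∀ {m S a b} → (∀ y → y ∈ m ∷ S → to y ≢ from m) →
    TransClosure (Arc G (m ∷ S)) a b → a ≢ from m → TransClosure (Arc G S) a b
  dropInitialMove {m} {S} unentered = go
    where
    dropArc : ∀ {a b} → Arc G (m ∷ S) a b → a ≢ from m → Arc G S a b
    dropArc (_ , here refl , from≡a , _) a≢from = ⊥-elim (a≢from (sym from≡a))
    dropArc (y , there y∈S , from≡a , to≡b) _ = y , y∈S , from≡a , to≡b
    go : ∀ {a b} → TransClosure (Arc G (m ∷ S)) a b → a ≢ from m → TransClosure (Arc G S) a b
    go [ arc ] a≢from = [ dropArc arc a≢from ]
    go (arc@(y , y∈ , _ , to≡) ∷ arcs) a≢from = dropArc arc a≢from ∷ go arcs (unentered y y∈ ∘ trans to≡)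

  regular⇒acyclic : ∀ s → Regular G s → Acyclic G s
  regular⇒acyclic []      _ (_ , [ _ , () , _ ])
  regular⇒acyclic []      _ (_ , (_ , () , _) ∷ _)
  regular⇒acyclic (m ∷ s) ((_ , unentered) , reg) (v , cycle) with y , y∈ , to≡v ← lastArc cycle =
    regular⇒acyclic s reg (v , dropInitialMove unentered cycle (unentered y y∈ ∘ trans to≡v))

  MultisetReachable : PebbleFunction G → Fin n → Set
  MultisetReachable p x = Σ (List (Move G)) λ S → NonNeg G (applySeq G W p S) × (1ℤ ≤ applySeq G W p S x)

  AcyclicReachable : PebbleFunction G → Fin n → Set
  AcyclicReachable p x =
    Σ (List (Move G)) λ R → Acyclic G R × NonNeg G (applySeq G W p R) × (1ℤ ≤ applySeq G W p R x)

  RegularReachable : PebbleFunction G → Fin n → Set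
  RegularReachable p x =
    Σ (List (Move G)) λ s → Regular G s × Executable G W p s × (1ℤ ≤ applySeq G W p s x)

  multiset⇒regular : ∀ {p x} → NonNeg G p → MultisetReachable p x → RegularReachable p x
  multiset⇒regular {p} {x} p≥0 (S , pS≥0 , x∈pS) =
    sequence , regular , executable , ≤-trans x∈pS (dominates x)
    where open Regularisation (regularise p≥0 S (<-wellFounded (length S)) pS≥0)

  regular⇒acyclic-reachable : ∀ {p x} → NonNeg G p → RegularReachable p x → AcyclicReachable p x
  regular⇒acyclic-reachable p≥0 (s , reg , exec , x∈ps) =
    s , regular⇒acyclic s reg , executable⇒nonneg s p≥0 exec , x∈ps

theorem3p4 : (n : ℕ) (G : SimpleGraph n) → Connected G → (W : Weight G)
    → (p : PebbleFunction G) → NonNeg G p → (x : Fin n)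
    → (Reachable G W p x
         ⇔ Σ (List (Move G)) (λ S → NonNeg G (applySeq G W p S) × (1ℤ ≤ applySeq G W p S x)))
      × (Σ (List (Move G)) (λ S → NonNeg G (applySeq G W p S) × (1ℤ ≤ applySeq G W p S x))
         ⇔ Σ (List (Move G)) (λ R → Acyclic G R × NonNeg G (applySeq G W p R) × (1ℤ ≤ applySeq G W p R x)))
      × (Σ (List (Move G)) (λ R → Acyclic G R × NonNeg G (applySeq G W p R) × (1ℤ ≤ applySeq G W p R x))
         ⇔ Σ (List (Move G)) (λ s → Regular G s × Executable G W p s × (1ℤ ≤ applySeq G W p s x)))
theorem3p4 n G _ W p p≥0 x =
    mk⇔ (λ (s , exec , x∈ps) → s , executable⇒nonneg s p≥0 exec , x∈ps)
        (λ S → let s , _ , exec , x∈ps = multiset⇒regular p≥0 S in s , exec , x∈ps)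
  , mk⇔ (regular⇒acyclic-reachable p≥0 ∘ multiset⇒regular p≥0)
        (λ (R , _ , pR≥0 , x∈pR) → R , pR≥0 , x∈pR)
  , mk⇔ (λ (R , _ , pR≥0 , x∈pR) → multiset⇒regular p≥0 (R , pR≥0 , x∈pR))
        (regular⇒acyclic-reachable p≥0)
  where open Pebbling G W
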